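{- There is an algorithm which, given an enumeration $f_C\colon\mathbb{N}\to\mathbb{N}$ of a set $C\subseteq\mathbb{N}$, computes enumerations without repetitions $f_A$ of a set $A\subseteq\mathbb{N}$ and $f_B$ of a set $B\subseteq\mathbb{N}$ such that (1) $C$ is the disjoint union of $A$ and $B$, and (2) there exist infinitely many $t$ with $A\cap\{0,\ldots,t-1\}\subseteq\mathrm{Enum}(f_A)[t]$ and infinitely many $t$ with $B\cap\{0,\ldots,t-1\}\subseteq\mathrm{Enum}(f_B)[t]$.
   Context: A total function $f\colon\mathbb{N}\to\mathbb{N}$ is an enumeration of $A\subseteq\mathbb{N}$ if $A=\{n:\exists k\, f(k)=n+1\}$ (value $0$ means nothing is enumerated at that stage). It is an enumeration without repetitions if for every $n\in A$ there is exactly one $k$ with $f(k)=n+1$. For $t\in\mathbb{N}$, $\mathrm{Enum}(f)[t]:=\{n\in\mathbb{N}:\exists k<t\, f(k)=n+1\}$. -}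

module Defs where

open import Level using (0ℓ)
open import Data.Nat using (ℕ; suc; _≤_; _<_)
open import Data.Product using (Σ; ∃; _×_)
open import Data.Sum using (_⊎_)
open import Relation.Nullary using (¬_)
open import Relation.Binary.PropositionalEquality using (_≡_)
open import Axiom.ExcludedMiddle using (ExcludedMiddle)

_∈Enum_ : ℕ → (ℕ → ℕ) → Set
n ∈Enum f = ∃ λ k → f k ≡ suc n

_∈Enum_at_ : ℕ → (ℕ → ℕ) → ℕ → Set
n ∈Enum f at t = ∃ λ k → k < t × f k ≡ suc n

NoRepetitions : (ℕ → ℕ) → Set
NoRepetitions f = ∀ n k k′ → f k ≡ suc n → f k′ ≡ suc n → k ≡ k′

GoodStage : (ℕ → ℕ) → ℕ → Set
GoodStage f t = ∀ n → n < t → n ∈Enum f → n ∈Enum f at t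

InfinitelyMany : (ℕ → Set) → Set
InfinitelyMany P = ∀ s → ∃ λ t → s ≤ t × P t

Spec : (ℕ → ℕ) → (ℕ → ℕ) → (ℕ → ℕ) → Set
Spec fC fA fB =
  NoRepetitions fA × NoRepetitions fB
  × (∀ n → n ∈Enum fC → n ∈Enum fA ⊎ n ∈Enum fB)
  × (∀ n → n ∈Enum fA ⊎ n ∈Enum fB → n ∈Enum fC)
  × (∀ n → ¬ (n ∈Enum fA × n ∈Enum fB))
  × InfinitelyMany (GoodStage fA)
  × InfinitelyMany (GoodStage fB)

-- Elements of C are routed to A or B at the stage where they are first enumerated. Alongside,
-- the construction keeps a list of markers (t , c), with increasing stamps t and alternating
-- colours c, each claiming that t is a good stage for colour c; every stage appends a new marker.
-- When n appears for the first time, every marker after the first one above n is discarded and n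
-- gets the colour opposite to that marker, so all surviving markers keep telling the truth.
-- Classically only finitely many elements below any bound are ever enumerated, so each initial
-- segment of the marker list eventually stops changing; a settled segment of length s + 2
-- contains markers of both colours with stamps at least s, and these are never discarded.

module Submission where

open import Defs
open import Data.Nat using (ℕ; zero; suc; _+_; _≤_; _<_; _≤?_; _<?_; _⊔_; z≤n; s≤s; s≤s⁻¹)
open import Data.Product using (Σ; ∃; ∃₂; _×_; _,_; proj₁; proj₂)
open import Level using (0ℓ)
open import Axiom.ExcludedMiddle using (ExcludedMiddle)

open import Data.Nat.Properties
open import Data.Bool using (Bool; true; false; not; if_then_else_)
open import Data.Bool.Properties using (not-¬; ¬-not) renaming (_≟_ to _≟ᴮ_)
open import Data.Maybe using (Maybe; just; nothing)
open import Data.List using (List; []; _∷_; _++_; [_]; length)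
open import Data.List.Properties using (++-assoc; ++-identityʳ; length-++)
open import Data.List.Relation.Unary.All using (All; []; _∷_)
import Data.List.Relation.Unary.All as All
open import Data.List.Relation.Unary.All.Properties using (++⁺; ++⁻ˡ)
open import Data.List.Relation.Unary.Any using (here; there)
open import Data.List.Membership.Propositional using (_∈_)
open import Data.List.Membership.Propositional.Properties using (∈-++⁺ˡ; ∈-++⁻)
open import Data.Sum using (_⊎_; inj₁; inj₂)
open import Relation.Nullary using (Dec; ¬_; yes; no; does; contradiction)
open import Relation.Nullary.Decidable using (dec-true)
open import Relation.Binary.PropositionalEquality using (_≡_; refl; sym; trans; cong; subst; module ≡-Reasoning)
open import Relation.Binary using (tri<; tri≈; tri>)
open import Function using (_∘_)

Marker : Set
Marker = ℕ × Bool

cutAbove : ℕ → List Marker → List Marker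
cutAbove n [] = []
cutAbove n ((t , c) ∷ xs) with t ≤? n
... | yes _ = (t , c) ∷ cutAbove n xs
... | no _ = (t , c) ∷ []

colourFor : ℕ → List Marker → Bool
colourFor n [] = true
colourFor n ((t , c) ∷ xs) with t ≤? n
... | yes _ = colourFor n xs
... | no _ = not c

alternate : Bool → List Marker → Bool
alternate b [] = b
alternate b (_ ∷ xs) = alternate (not b) xs

extend : ℕ → List Marker → List Marker
extend t xs = xs ++ [ (t , alternate true xs) ]

step : Maybe ℕ → List Marker → List Marker
step nothing xs = xs
step (just n) xs = cutAbove n xs

route : Bool → Maybe ℕ → List Marker → ℕ
route c nothing xs = 0
route c (just n) xs = if does (colourFor n xs ≟ᴮ c) then suc n else 0

cutAbove-prefix : ∀ n xs → ∃ λ ys → cutAbove n xs ++ ys ≡ xs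
cutAbove-prefix n [] = [] , refl
cutAbove-prefix n ((t , c) ∷ xs) with t ≤? n
... | yes _ = let ys , eq = cutAbove-prefix n xs in ys , cong ((t , c) ∷_) eq
... | no _ = xs , refl

cutAbove-++ : ∀ {n} P xs → All (λ x → proj₁ x ≤ n) P → cutAbove n (P ++ xs) ≡ P ++ cutAbove n xs
cutAbove-++ [] xs [] = refl
cutAbove-++ {n} ((t , c) ∷ P) xs (t≤n ∷ P≤n) with t ≤? n
... | yes _ = cong ((t , c) ∷_) (cutAbove-++ P xs P≤n)
... | no t≰n = contradiction t≤n t≰n

cutAbove-head : ∀ n x xs → ∃ λ ys → cutAbove n (x ∷ xs) ≡ x ∷ ys
cutAbove-head n (t , c) xs with t ≤? n
... | yes _ = cutAbove n xs , refl
... | no _ = [] , refl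

∈-cutAbove⇒colourFor : ∀ {n t c} xs → (t , c) ∈ cutAbove n xs → n < t → colourFor n xs ≡ not c
∈-cutAbove⇒colourFor {n} ((t′ , c′) ∷ xs) t,c∈ n<t with t′ ≤? n | t,c∈
... | yes _ | there t,c∈′ = ∈-cutAbove⇒colourFor xs t,c∈′ n<t
... | yes t′≤n | here refl = contradiction t′≤n (<⇒≱ n<t)
... | no _ | here refl = refl

step-prefix : ∀ m xs → ∃ λ ys → step m xs ++ ys ≡ xs
step-prefix nothing xs = [] , ++-identityʳ xs
step-prefix (just n) xs = cutAbove-prefix n xs

step-++ : ∀ m P xs → (∀ {n} → m ≡ just n → All (λ x → proj₁ x ≤ n) P) → step m (P ++ xs) ≡ P ++ step m xs
step-++ nothing P xs _ = refl
step-++ (just n) P xs P≤ = cutAbove-++ P xs (P≤ refl)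

step-head : ∀ m x xs → ∃ λ ys → step m (x ∷ xs) ≡ x ∷ ys
step-head nothing x xs = xs , refl
step-head (just n) x xs = cutAbove-head n x xs

∈-extend⁻ : ∀ {x} t xs → x ∈ extend t xs → x ∈ xs ⊎ proj₁ x ≡ t
∈-extend⁻ t xs x∈ with ∈-++⁻ xs x∈
... | inj₁ x∈xs = inj₁ x∈xs
... | inj₂ (here refl) = inj₂ refl

route-inv : ∀ {c n} m xs → route c m xs ≡ suc n → m ≡ just n × colourFor n xs ≡ c
route-inv {c} (just m) xs eq with colourFor m xs ≟ᴮ c
route-inv (just m) xs refl | yes col = refl , col

route-just : ∀ {c n} xs → colourFor n xs ≡ c → route c (just n) xs ≡ suc n
route-just {c} {n} xs col rewrite dec-true (colourFor n xs ≟ᴮ c) col = refl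

data Chain : ℕ → Bool → List Marker → Set where
  [] : ∀ {lo b} → Chain lo b []
  _∷_ : ∀ {lo b t xs} → lo ≤ t → Chain (suc t) (not b) xs → Chain lo b ((t , b) ∷ xs)

Chain-++⁻ˡ : ∀ {lo b} xs ys → Chain lo b (xs ++ ys) → Chain lo b xs
Chain-++⁻ˡ [] ys ch = []
Chain-++⁻ˡ (x ∷ xs) ys (lo≤t ∷ ch) = lo≤t ∷ Chain-++⁻ˡ xs ys ch

Chain-∷ʳ : ∀ {lo b t} xs → Chain lo b xs → lo ≤ t → All (λ x → proj₁ x < t) xs →
           Chain lo b (xs ++ [ (t , alternate b xs) ])
Chain-∷ʳ [] [] lo≤t [] = lo≤t ∷ []
Chain-∷ʳ (x ∷ xs) (lo≤t′ ∷ ch) lo≤t (t′<t ∷ xs<t) = lo≤t′ ∷ Chain-∷ʳ xs ch t′<t xs<t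

Chain-colour : ∀ s {lo b} xs → Chain lo b xs → s + 2 ≤ length xs → ∀ c → ∃ λ t → (t , c) ∈ xs × lo + s ≤ t
Chain-colour zero {b = b} ((t , _) ∷ (t′ , _) ∷ _) (lo≤t ∷ t<t′ ∷ _) _ c with b ≟ᴮ c
... | yes refl = t , here refl , ≤-trans (≤-reflexive (+-identityʳ _)) lo≤t
... | no b≢c rewrite ¬-not (b≢c ∘ sym) =
  t′ , there (here refl) , ≤-trans (≤-reflexive (+-identityʳ _)) (≤-trans lo≤t (<⇒≤ t<t′))
Chain-colour (suc s) {lo} ((t , _) ∷ xs) (lo≤t ∷ ch) (s≤s len) c =
  let t′ , t′,c∈ , 1+t+s≤t′ = Chain-colour s xs ch len c
  in t′ , there t′,c∈ , ≤-trans (≤-reflexive (+-suc lo s)) (≤-trans (s≤s (+-monoˡ-≤ s lo≤t)) 1+t+s≤t′)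
Chain-colour zero (_ ∷ []) (_ ∷ []) (s≤s ()) c

module Split (f : ℕ → ℕ) where

  enumeratedBefore? : ∀ n k → Dec (n ∈Enum f at k)
  enumeratedBefore? n k = anyUpTo? (λ j → f j ≟ suc n) k

  FirstAt : ℕ → ℕ → Set
  FirstAt k n = f k ≡ suc n × ¬ (n ∈Enum f at k)

  newAt : ℕ → Maybe ℕ
  newAt k with f k
  ... | zero = nothing
  ... | suc n with enumeratedBefore? n k
  ...   | yes _ = nothing
  ...   | no _ = just n

  newAt-sound : ∀ {k n} → newAt k ≡ just n → FirstAt k n
  newAt-sound {k} eq with f k
  ... | suc m with enumeratedBefore? m k
  newAt-sound refl | suc m | no fresh = refl , fresh

  newAt-complete : ∀ {k n} → FirstAt k n → newAt k ≡ just n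
  newAt-complete {k} {n} (fk , fresh) rewrite fk with enumeratedBefore? n k
  ... | yes before = contradiction before fresh
  ... | no _ = refl

  FirstAt-unique : ∀ {k k′ n} → FirstAt k n → FirstAt k′ n → k ≡ k′
  FirstAt-unique {k} {k′} (fk , fresh) (fk′ , fresh′) with <-cmp k k′
  ... | tri< k<k′ _ _ = contradiction (k , k<k′ , fk) fresh′
  ... | tri≈ _ k≡k′ _ = k≡k′
  ... | tri> _ _ k′<k = contradiction (k′ , k′<k , fk′) fresh

  ∈Enum-at⇒FirstAt : ∀ {n} k → n ∈Enum f at k → ∃ λ j → FirstAt j n
  ∈Enum-at⇒FirstAt {n} (suc k) (j , j<1+k , fj) with enumeratedBefore? n k
  ... | yes before = ∈Enum-at⇒FirstAt k before
  ... | no fresh with m<1+n⇒m<n∨m≡n j<1+k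
  ...   | inj₁ j<k = contradiction (j , j<k , fj) fresh
  ...   | inj₂ refl = j , fj , fresh

  markers : ℕ → List Marker
  markers zero = []
  markers (suc k) = extend (suc k) (step (newAt k) (markers k))

  emit : Bool → ℕ → ℕ
  emit c k = route c (newAt k) (markers k)

  emit-inv : ∀ {c k n} → emit c k ≡ suc n → FirstAt k n × colourFor n (markers k) ≡ c
  emit-inv {k = k} eq with route-inv (newAt k) (markers k) eq
  ... | new , col = newAt-sound new , col

  emit-intro : ∀ {c k n} → FirstAt k n → colourFor n (markers k) ≡ c → emit c k ≡ suc n
  emit-intro {k = k} first col rewrite newAt-complete first = route-just (markers k) col

  emit-noRepetitions : ∀ c → NoRepetitions (emit c)
  emit-noRepetitions c n k k′ eq eq′ = FirstAt-unique (proj₁ (emit-inv eq)) (proj₁ (emit-inv eq′))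

  emit-complete : ∀ n → n ∈Enum f → n ∈Enum emit true ⊎ n ∈Enum emit false
  emit-complete n (k , fk) with ∈Enum-at⇒FirstAt (suc k) (k , ≤-refl , fk)
  ... | j , first with colourFor n (markers j) in col
  ... | true = inj₁ (j , emit-intro first col)
  ... | false = inj₂ (j , emit-intro first col)

  emit-sound : ∀ n → n ∈Enum emit true ⊎ n ∈Enum emit false → n ∈Enum f
  emit-sound n (inj₁ (k , eq)) = k , proj₁ (proj₁ (emit-inv eq))
  emit-sound n (inj₂ (k , eq)) = k , proj₁ (proj₁ (emit-inv eq))

  emit-disjoint : ∀ n → ¬ (n ∈Enum emit true × n ∈Enum emit false)
  emit-disjoint n ((k , eq) , (k′ , eq′)) with emit-inv eq | emit-inv eq′
  ... | first , col | first′ , col′ with FirstAt-unique first first′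
  ... | refl with trans (sym col) col′
  ... | ()

  markers-chain : ∀ k → Chain 0 true (markers k) × All (λ x → proj₁ x ≤ k) (markers k)
  markers-chain zero = [] , []
  markers-chain (suc k) =
    let ch , bounded = markers-chain k
        xs = step (newAt k) (markers k)
        ys , xs++ys≡ = step-prefix (newAt k) (markers k)
        xs-bounded = ++⁻ˡ xs (subst (All (λ x → proj₁ x ≤ k)) (sym xs++ys≡) bounded)
    in Chain-∷ʳ xs (Chain-++⁻ˡ xs ys (subst (Chain 0 true) (sym xs++ys≡) ch)) z≤n (All.map s≤s xs-bounded)
     , ++⁺ (All.map m≤n⇒m≤1+n xs-bounded) (≤-refl ∷ [])

  ∈-markers-pred : ∀ {t c} k → (t , c) ∈ markers (suc k) → t ≤ k → (t , c) ∈ markers k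
  ∈-markers-pred {t} {c} k t,c∈ t≤k with ∈-extend⁻ (suc k) (step (newAt k) (markers k)) t,c∈
  ... | inj₁ t,c∈xs = let ys , eq = step-prefix (newAt k) (markers k) in subst ((t , c) ∈_) eq (∈-++⁺ˡ t,c∈xs)
  ... | inj₂ refl = contradiction t≤k (n≮n k)

  ∈-markers-antitone : ∀ {t c k} k′ → t ≤ k → k ≤ k′ → (t , c) ∈ markers k′ → (t , c) ∈ markers k
  ∈-markers-antitone zero t≤k z≤n t,c∈ = t,c∈
  ∈-markers-antitone {k = k} (suc k′) t≤k k≤1+k′ t,c∈ with m≤n⇒m<n∨m≡n k≤1+k′
  ... | inj₂ refl = t,c∈
  ... | inj₁ (s≤s k≤k′) = ∈-markers-antitone k′ t≤k k≤k′ (∈-markers-pred k′ t,c∈ (≤-trans t≤k k≤k′))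

  emit-goodStage : ∀ {t c} → (∀ {k} → t ≤ k → (t , c) ∈ markers k) → GoodStage (emit c) t
  emit-goodStage {t} {c} alive n n<t (k , eq) with k <? t
  ... | yes k<t = k , k<t , eq
  ... | no k≮t with emit-inv eq
  ... | first , col with ∈-extend⁻ (suc k) (step (newAt k) (markers k)) (alive (m≤n⇒m≤1+n (≮⇒≥ k≮t)))
  ... | inj₂ refl = contradiction (≮⇒≥ k≮t) (n≮n k)
  ... | inj₁ t,c∈ rewrite newAt-complete first =
    contradiction (trans (sym col) (∈-cutAbove⇒colourFor (markers k) t,c∈ n<t)) (not-¬ refl)

  SettledFrom : ℕ → List Marker → Set
  SettledFrom K P = ∀ {k} → K ≤ k → ∃ λ R → markers k ≡ P ++ R

  BelowNewFrom : ℕ → List Marker → Set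
  BelowNewFrom K P = ∀ {k n} → K ≤ k → FirstAt k n → All (λ x → proj₁ x ≤ n) P

  markers-suc-++ : ∀ {K P k} ys → BelowNewFrom K P → K ≤ k → markers k ≡ P ++ ys →
                   markers (suc k) ≡ P ++ step (newAt k) ys ++ [ (suc k , alternate true (step (newAt k) (markers k))) ]
  markers-suc-++ {P = P} {k} ys below K≤k eq = begin
    step (newAt k) (markers k) ++ [ new ]   ≡⟨ cong (λ xs → step (newAt k) xs ++ [ new ]) eq ⟩
    step (newAt k) (P ++ ys) ++ [ new ]     ≡⟨ cong (_++ [ new ]) (step-++ (newAt k) P ys (below K≤k ∘ newAt-sound)) ⟩
    (P ++ step (newAt k) ys) ++ [ new ]     ≡⟨ ++-assoc P (step (newAt k) ys) [ new ] ⟩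
    P ++ step (newAt k) ys ++ [ new ]       ∎
    where
      open ≡-Reasoning
      new = (suc k , alternate true (step (newAt k) (markers k)))

  markers-suc-keeps : ∀ {K P k y R} → BelowNewFrom K P → K ≤ k →
                      markers k ≡ P ++ y ∷ R → ∃ λ R′ → markers (suc k) ≡ P ++ y ∷ R′
  markers-suc-keeps {k = k} {y} {R} below K≤k eq with step-head (newAt k) y R | markers-suc-++ (y ∷ R) below K≤k eq
  ... | R′ , kept | eq′ rewrite kept = _ , eq′

  markers-suc-grows : ∀ {K P k} ys → BelowNewFrom K P → K ≤ k →
                      markers k ≡ P ++ ys → ∃₂ λ y R → markers (suc k) ≡ P ++ y ∷ R
  markers-suc-grows {k = k} ys below K≤k eq with step (newAt k) ys | markers-suc-++ ys below K≤k eq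
  ... | [] | eq′ = _ , [] , eq′
  ... | y ∷ R | eq′ = y , _ , eq′

  module _ (em : ExcludedMiddle 0ℓ) where

    eventually-newAbove : ∀ bound → ∃ λ K → ∀ {k n} → K ≤ k → FirstAt k n → bound ≤ n
    eventually-newAbove zero = 0 , λ _ _ → z≤n
    eventually-newAbove (suc v) with eventually-newAbove v | em {v ∈Enum f}
    ... | K , above | yes (k₀ , fk₀) = K ⊔ suc k₀ , λ K⊔1+k₀≤k first →
      ≤∧≢⇒< (above (≤-trans (m≤m⊔n K (suc k₀)) K⊔1+k₀≤k) first)
            λ { refl → proj₂ first (k₀ , ≤-trans (m≤n⊔m K (suc k₀)) K⊔1+k₀≤k , fk₀) }
    ... | K , above | no never = K , λ K≤k first →
      ≤∧≢⇒< (above K≤k first) λ { refl → never (_ , proj₁ first) }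

    SettledFrom-∷ʳ : ∀ {K P} → SettledFrom K P → ∃₂ λ K′ y → SettledFrom K′ (P ++ [ y ])
    SettledFrom-∷ʳ {K} {P} settled =
      suc K″ , y , λ le → let R , eq = settled-∷ le in R , trans eq (sym (++-assoc P [ y ] R))
      where
        K′ = proj₁ (eventually-newAbove K)
        K″ = K ⊔ K′
        P-bounded : All (λ x → proj₁ x ≤ K) P
        P-bounded = let R , eq = settled ≤-refl in
          ++⁻ˡ P (subst (All (λ x → proj₁ x ≤ K)) eq (proj₂ (markers-chain K)))
        below : BelowNewFrom K″ P
        below K″≤k first =
          All.map (λ x≤K → ≤-trans x≤K (proj₂ (eventually-newAbove K) (≤-trans (m≤n⊔m K K′) K″≤k) first)) P-bounded
        grown : ∃₂ λ y R → markers (suc K″) ≡ P ++ y ∷ R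
        grown = let R , eq = settled (m≤m⊔n K K′) in markers-suc-grows R below ≤-refl eq
        y = proj₁ grown
        settled-∷ : ∀ {k} → suc K″ ≤ k → ∃ λ R → markers k ≡ P ++ y ∷ R
        settled-∷ {suc k} 1+K″≤1+k with m≤n⇒m<n∨m≡n (s≤s⁻¹ 1+K″≤1+k)
        ... | inj₂ refl = proj₂ grown
        ... | inj₁ K″<k = markers-suc-keeps below (<⇒≤ K″<k) (proj₂ (settled-∷ K″<k))

    settled-of-length : ∀ m → ∃₂ λ K P → length P ≡ m × SettledFrom K P
    settled-of-length zero = 0 , [] , refl , λ {k} _ → markers k , refl
    settled-of-length (suc m) with settled-of-length m
    ... | K , P , len , settled with SettledFrom-∷ʳ settled
    ... | K′ , y , settled′ = K′ , P ++ [ y ] , trans (length-++ P) (trans (cong (_+ 1) len) (+-comm m 1)) , settled′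

    settled-alive : ∀ {K P t c} → SettledFrom K P → (t , c) ∈ P → ∀ {k} → t ≤ k → (t , c) ∈ markers k
    settled-alive {K} {P} {t} {c} settled t,c∈ {k} t≤k with K ≤? k
    ... | yes K≤k = let R , eq = settled K≤k in subst ((t , c) ∈_) (sym eq) (∈-++⁺ˡ t,c∈)
    ... | no K≰k = let R , eq = settled ≤-refl in
      ∈-markers-antitone K t≤k (<⇒≤ (≰⇒> K≰k)) (subst ((t , c) ∈_) (sym eq) (∈-++⁺ˡ t,c∈))

    emit-infinitelyManyGoodStages : ∀ c → InfinitelyMany (GoodStage (emit c))
    emit-infinitelyManyGoodStages c s with settled-of-length (s + 2)
    ... | K , P , len , settled =
      let R , eq = settled ≤-refl
          chain = Chain-++⁻ˡ P R (subst (Chain 0 true) eq (proj₁ (markers-chain K)))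
          t , t,c∈ , s≤t = Chain-colour s P chain (≤-reflexive (sym len)) c
      in t , s≤t , emit-goodStage (settled-alive settled t,c∈)

theorem9p2 : Σ ((ℕ → ℕ) → (ℕ → ℕ) × (ℕ → ℕ)) λ alg →
               ExcludedMiddle 0ℓ → ∀ (fC : ℕ → ℕ) →
                 Spec fC (proj₁ (alg fC)) (proj₂ (alg fC))
theorem9p2 = (λ f → emit f true , emit f false) , λ em f →
    emit-noRepetitions f true , emit-noRepetitions f false
  , emit-complete f , emit-sound f , emit-disjoint f
  , emit-infinitelyManyGoodStages f em true , emit-infinitelyManyGoodStages f em false
  where open Split
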